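{- Let $d\ge1$ and $a,b\in\{0,1\}^d$ with $a\cdot b=0$. Then $\mathrm{EDIT}(\mathrm{AG}_1(a),\mathrm{AG}_2(b))\le 2l_2+l+dl_0$.
   Context: $\mathrm{EDIT}(x,y)$ is the edit distance (minimum number of single-symbol insertions, deletions, substitutions transforming $x$ into $y$). $c^i$ denotes symbol $c$ repeated $i$ times; $\bigcirc$ denotes concatenation; $a\cdot b=\sum_j a_jb_j$. Let $l_0=1000d$, $l_1=(1000d)^2$, $l_2=(1000d)^3$, $l=d(4l_0+2l_1)$. $\mathrm{CG}_1(0)=0^{l_1}0^{l_0}1^{l_0}1^{l_0}1^{l_0}0^{l_1}$, $\mathrm{CG}_1(1)=0^{l_1}0^{l_0}0^{l_0}0^{l_0}1^{l_0}0^{l_1}$, $\mathrm{CG}_2(0)=0^{l_1}0^{l_0}0^{l_0}1^{l_0}1^{l_0}0^{l_1}$, $\mathrm{CG}_2(1)=0^{l_1}1^{l_0}1^{l_0}1^{l_0}1^{l_0}0^{l_1}$, $g=0^{l_1/2-1}1\,0^{l_1/2}0^{l_0}1^{l_0}1^{l_0}1^{l_0}0^{l_1}$. $L=\bigcirc_{i=1}^d g$, $R=\bigcirc_{i=1}^d\mathrm{CG}_1(a_i)$, $D=\bigcirc_{i=1}^d\mathrm{CG}_2(b_i)$, $\mathrm{AG}_1(a)=0^{l_2}L1^{l_2}R0^{l_2}$, $\mathrm{AG}_2(b)=1^{l_2}D1^{l_2}$. -}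

module Defs where

open import Data.Nat using (ℕ; zero; suc; _+_; _*_; _⊓_; _∸_)
open import Data.Bool using (Bool; true; false; if_then_else_)
open import Data.List using (List; []; _∷_; _++_; replicate; concat; map; length)
open import Data.Vec using (Vec; toList; []; _∷_)
open import Relation.Nullary using (does)
import Data.Bool.Properties as BP

-- Binary strings; symbol 0 = false, symbol 1 = true.
Str : Set
Str = List Bool

EDIT : Str → Str → ℕ
EDIT [] ys = length ys
EDIT (x ∷ xs) [] = suc (length xs)
EDIT (x ∷ xs) (y ∷ ys) =
  (suc (EDIT xs (y ∷ ys)) ⊓ suc (EDIT (x ∷ xs) ys))
    ⊓ (EDIT xs ys + (if does (x BP.≟ y) then 0 else 1))

_^^_ : Bool → ℕ → Str
c ^^ i = replicate i c

O I : Bool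
O = false
I = true

module Gadgets (d : ℕ) where
  l₀ l₁ l₂ l : ℕ
  l₀ = 1000 * d
  l₁ = l₀ * l₀
  l₂ = l₀ * l₀ * l₀
  l  = d * (4 * l₀ + 2 * l₁)

  -- l₁ / 2 (l₁ = (1000d)² is even)
  l₁/2 : ℕ
  l₁/2 = 500000 * d * d

  CG₁ : Bool → Str
  CG₁ false = (O ^^ l₁) ++ (O ^^ l₀) ++ (I ^^ l₀) ++ (I ^^ l₀) ++ (I ^^ l₀) ++ (O ^^ l₁)
  CG₁ true  = (O ^^ l₁) ++ (O ^^ l₀) ++ (O ^^ l₀) ++ (O ^^ l₀) ++ (I ^^ l₀) ++ (O ^^ l₁)

  CG₂ : Bool → Str
  CG₂ false = (O ^^ l₁) ++ (O ^^ l₀) ++ (O ^^ l₀) ++ (I ^^ l₀) ++ (I ^^ l₀) ++ (O ^^ l₁)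
  CG₂ true  = (O ^^ l₁) ++ (I ^^ l₀) ++ (I ^^ l₀) ++ (I ^^ l₀) ++ (I ^^ l₀) ++ (O ^^ l₁)

  g : Str
  g = (O ^^ (l₁/2 ∸ 1)) ++ (I ∷ []) ++ (O ^^ l₁/2) ++ (O ^^ l₀)
        ++ (I ^^ l₀) ++ (I ^^ l₀) ++ (I ^^ l₀) ++ (O ^^ l₁)

  L : Str
  L = concat (replicate d g)

  R : Vec Bool d → Str
  R a = concat (map CG₁ (toList a))

  D : Vec Bool d → Str
  D b = concat (map CG₂ (toList b))

  AG₁ : Vec Bool d → Str
  AG₁ a = (O ^^ l₂) ++ L ++ (I ^^ l₂) ++ R a ++ (O ^^ l₂)

  AG₂ : Vec Bool d → Str
  AG₂ b = (I ^^ l₂) ++ D b ++ (I ^^ l₂)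

toℕ : Bool → ℕ
toℕ false = 0
toℕ true  = 1

dot : {d : ℕ} → Vec Bool d → Vec Bool d → ℕ
dot [] [] = 0
dot (x ∷ xs) (y ∷ ys) = toℕ x * toℕ y + dot xs ys

{-# OPTIONS --safe #-}
-- Delete the prefix 0^{l₂} L outright (l₂ + l deletions) and substitute
-- symbol by symbol in what remains: 1^{l₂} R 0^{l₂} against 1^{l₂} D 1^{l₂}.
-- The 1^{l₂} blocks agree, 0^{l₂} against 1^{l₂} costs l₂, and since a · b = 0
-- each pair CG₁(aᵢ), CG₂(bᵢ) differs in a single run of length l₀.
-- Edit distance is subadditive over concatenation, so these costs simply add up.
module Submission where

open import Defs
open import Data.Nat using (ℕ; zero; suc; _+_; _*_; _∸_; _⊓_; _≤_; z≤n; s≤s)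
open import Data.Nat.Properties
open import Data.Nat.Tactic.RingSolver using (solve-∀)
open import Data.Bool using (Bool; true; false; if_then_else_)
open import Data.List using ([]; _∷_; _++_; replicate; concat; map; length)
open import Data.List.Properties using (length-++; length-replicate)
open import Data.Vec using (Vec; toList; []; _∷_)
open import Relation.Nullary using (does)
open import Relation.Binary.PropositionalEquality
  using (_≡_; refl; sym; trans; cong; cong₂; module ≡-Reasoning)
open import Algebra.Properties.CommutativeSemigroup +-commutativeSemigroup using (xy∙z≈xz∙y)
import Data.Bool.Properties as BP

mismatch : Bool → Bool → ℕ
mismatch x y = if does (x BP.≟ y) then 0 else 1

mismatch-refl : ∀ x → mismatch x x ≡ 0
mismatch-refl false = refl
mismatch-refl true  = refl

mismatch≤1 : ∀ x y → mismatch x y ≤ 1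
mismatch≤1 false false = z≤n
mismatch≤1 false true  = ≤-refl
mismatch≤1 true  false = ≤-refl
mismatch≤1 true  true  = z≤n

EDIT-[]ʳ : ∀ xs → EDIT xs [] ≡ length xs
EDIT-[]ʳ []      = refl
EDIT-[]ʳ (_ ∷ _) = refl

EDIT-∷ˡ-≤ : ∀ x xs ys → EDIT (x ∷ xs) ys ≤ suc (EDIT xs ys)
EDIT-∷ˡ-≤ x xs []      = ≤-reflexive (cong suc (sym (EDIT-[]ʳ xs)))
EDIT-∷ˡ-≤ x xs (_ ∷ _) = ≤-trans (m⊓n≤m _ _) (m⊓n≤m _ _)

EDIT-∷ʳ-≤ : ∀ xs y ys → EDIT xs (y ∷ ys) ≤ suc (EDIT xs ys)
EDIT-∷ʳ-≤ []      y ys = ≤-refl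
EDIT-∷ʳ-≤ (_ ∷ _) y ys = ≤-trans (m⊓n≤m _ _) (m⊓n≤n _ _)

EDIT-∷-∷-≤ : ∀ x xs y ys → EDIT (x ∷ xs) (y ∷ ys) ≤ EDIT xs ys + mismatch x y
EDIT-∷-∷-≤ x xs y ys = m⊓n≤n _ _

EDIT-∷-∷-≤-+ : ∀ x xs y ys e {p q r} →
  EDIT xs (y ∷ ys) ≤ p + e → EDIT (x ∷ xs) ys ≤ q + e → EDIT xs ys ≤ r + e →
  EDIT (x ∷ xs) (y ∷ ys) ≤ ((suc p ⊓ suc q) ⊓ (r + mismatch x y)) + e
EDIT-∷-∷-≤-+ x xs y ys e {p} {q} {r} del ins sub = begin
    EDIT (x ∷ xs) (y ∷ ys)
  ≤⟨ ⊓-glb (⊓-glb (≤-trans (EDIT-∷ˡ-≤ x xs (y ∷ ys)) (s≤s del))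
                  (≤-trans (EDIT-∷ʳ-≤ (x ∷ xs) y ys) (s≤s ins)))
           (≤-trans (EDIT-∷-∷-≤ x xs y ys) (≤-trans (+-monoˡ-≤ (mismatch x y) sub)
             (≤-reflexive (xy∙z≈xz∙y r e (mismatch x y))))) ⟩
    ((suc p + e) ⊓ (suc q + e)) ⊓ (r + mismatch x y + e)
  ≡⟨ sym (cong (_⊓ (r + mismatch x y + e)) (+-distribʳ-⊓ e (suc p) (suc q))) ⟩
    ((suc p ⊓ suc q) + e) ⊓ (r + mismatch x y + e)
  ≡⟨ sym (+-distribʳ-⊓ e (suc p ⊓ suc q) (r + mismatch x y)) ⟩
    ((suc p ⊓ suc q) ⊓ (r + mismatch x y)) + e
  ∎
  where open ≤-Reasoning

EDIT-++-≤ : ∀ xs ys us vs → EDIT (xs ++ ys) (us ++ vs) ≤ EDIT xs us + EDIT ys vs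
EDIT-++-≤ [] ys [] vs = ≤-refl
EDIT-++-≤ [] ys (u ∷ us) vs =
  ≤-trans (EDIT-∷ʳ-≤ ys u (us ++ vs)) (s≤s (EDIT-++-≤ [] ys us vs))
EDIT-++-≤ (x ∷ xs) ys [] vs =
  ≤-trans (EDIT-∷ˡ-≤ x (xs ++ ys) vs)
    (s≤s (≤-trans (EDIT-++-≤ xs ys [] vs)
      (≤-reflexive (cong (_+ EDIT ys vs) (EDIT-[]ʳ xs)))))
EDIT-++-≤ (x ∷ xs) ys (u ∷ us) vs =
  EDIT-∷-∷-≤-+ x (xs ++ ys) u (us ++ vs) (EDIT ys vs)
    (EDIT-++-≤ xs ys (u ∷ us) vs) (EDIT-++-≤ (x ∷ xs) ys us vs) (EDIT-++-≤ xs ys us vs)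

EDIT-refl : ∀ xs → EDIT xs xs ≡ 0
EDIT-refl []       = refl
EDIT-refl (x ∷ xs) = n≤0⇒n≡0 (≤-trans (EDIT-∷-∷-≤ x xs x xs)
  (≤-reflexive (cong₂ _+_ (EDIT-refl xs) (mismatch-refl x))))

EDIT≤length : ∀ xs ys → length xs ≡ length ys → EDIT xs ys ≤ length xs
EDIT≤length []       []       _ = z≤n
EDIT≤length (x ∷ xs) (y ∷ ys) ∣xs∣≡∣ys∣ = ≤-trans (EDIT-∷-∷-≤ x xs y ys)
  (≤-trans (+-mono-≤ (EDIT≤length xs ys (suc-injective ∣xs∣≡∣ys∣)) (mismatch≤1 x y))
    (≤-reflexive (+-comm (length xs) 1)))

EDIT-replicate-≤ : ∀ c c' n → EDIT (c ^^ n) (c' ^^ n) ≤ n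
EDIT-replicate-≤ c c' n = ≤-trans
  (EDIT≤length (c ^^ n) (c' ^^ n) (trans (length-replicate n) (sym (length-replicate n))))
  (≤-reflexive (length-replicate n))

EDIT-++-deleteˡ : ∀ xs ys zs → EDIT (xs ++ ys) zs ≤ length xs + EDIT ys zs
EDIT-++-deleteˡ xs ys zs = ≤-trans (EDIT-++-≤ xs ys [] zs)
  (≤-reflexive (cong (_+ EDIT ys zs) (EDIT-[]ʳ xs)))

EDIT-++-sharedˡ : ∀ us {xs ys n} → EDIT xs ys ≤ n → EDIT (us ++ xs) (us ++ ys) ≤ n
EDIT-++-sharedˡ us {xs} {ys} ≤n = ≤-trans (EDIT-++-≤ us xs us ys)
  (≤-trans (≤-reflexive (cong (_+ EDIT xs ys) (EDIT-refl us))) ≤n)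

EDIT-++-sharedʳ : ∀ xs ys {vs n} → EDIT xs ys ≤ n → EDIT (xs ++ vs) (ys ++ vs) ≤ n
EDIT-++-sharedʳ xs ys {vs} ≤n = ≤-trans (EDIT-++-≤ xs vs ys vs)
  (≤-trans (≤-reflexive (trans (cong (EDIT xs ys +_) (EDIT-refl vs)) (+-identityʳ _))) ≤n)

length-concat-replicate : ∀ n (xs : Str) → length (concat (replicate n xs)) ≡ n * length xs
length-concat-replicate zero    xs = refl
length-concat-replicate (suc n) xs =
  trans (length-++ xs) (cong (length xs +_) (length-concat-replicate n xs))

length-replicate-++ : ∀ n {c : Bool} {ys m} → length ys ≡ m → length ((c ^^ n) ++ ys) ≡ n + m
length-replicate-++ n {c} ∣ys∣≡m =
  trans (length-++ (c ^^ n)) (cong₂ _+_ (length-replicate n) ∣ys∣≡m)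

length-g-runs : ∀ h p q → 1 ≤ h → h + h ≡ q →
  (h ∸ 1) + (1 + (h + (p + (p + (p + (p + q)))))) ≡ 4 * p + 2 * q
length-g-runs (suc h) p _ _ refl = lemma h p
  where
  lemma : ∀ h p → h + (1 + (suc h + (p + (p + (p + (p + (suc h + suc h)))))))
                    ≡ 4 * p + 2 * (suc h + suc h)
  lemma = solve-∀

module _ (d : ℕ) where
  open Gadgets d

  -- g begins with the run 0^(l₁/2 ∸ 1), so its length is 4l₀ + 2l₁ only when
  -- l₁/2 ≥ 1; this is the one place where d ≥ 1 is used.
  length-L : 1 ≤ d → length L ≡ l
  length-L 1≤d = trans (length-concat-replicate d g) (cong (d *_) length-g)
    where
    l₁/2+l₁/2≡l₁ : ∀ n → 500000 * n * n + 500000 * n * n ≡ 1000 * n * (1000 * n)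
    l₁/2+l₁/2≡l₁ = solve-∀
    1≤l₁/2 : 1 ≤ l₁/2
    1≤l₁/2 = *-mono-≤ (*-mono-≤ (s≤s {0} {499999} z≤n) 1≤d) 1≤d
    length-g : length g ≡ 4 * l₀ + 2 * l₁
    length-g = begin
        length g
      ≡⟨ length-replicate-++ (l₁/2 ∸ 1) (cong suc (length-replicate-++ l₁/2
           (length-replicate-++ l₀ (length-replicate-++ l₀ (length-replicate-++ l₀
             (length-replicate-++ l₀ (length-replicate l₁))))))) ⟩
        (l₁/2 ∸ 1) + (1 + (l₁/2 + (l₀ + (l₀ + (l₀ + (l₀ + l₁))))))
      ≡⟨ length-g-runs l₁/2 l₀ l₁ 1≤l₁/2 (l₁/2+l₁/2≡l₁ d) ⟩
        4 * l₀ + 2 * l₁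
      ∎
      where open ≡-Reasoning

  EDIT-CG : ∀ x y → toℕ x * toℕ y ≡ 0 → EDIT (CG₁ x) (CG₂ y) ≤ l₀
  EDIT-CG false false _ =
    EDIT-++-sharedˡ (O ^^ l₁) (EDIT-++-sharedˡ (O ^^ l₀)
      (EDIT-++-sharedʳ (I ^^ l₀) (O ^^ l₀) (EDIT-replicate-≤ I O l₀)))
  EDIT-CG false true _ =
    EDIT-++-sharedˡ (O ^^ l₁)
      (EDIT-++-sharedʳ (O ^^ l₀) (I ^^ l₀) (EDIT-replicate-≤ O I l₀))
  EDIT-CG true false _ =
    EDIT-++-sharedˡ (O ^^ l₁) (EDIT-++-sharedˡ (O ^^ l₀) (EDIT-++-sharedˡ (O ^^ l₀)
      (EDIT-++-sharedʳ (O ^^ l₀) (I ^^ l₀) (EDIT-replicate-≤ O I l₀))))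
  EDIT-CG true true ()

  EDIT-R-D : ∀ {n} (as bs : Vec Bool n) → dot as bs ≡ 0 →
    EDIT (concat (map CG₁ (toList as))) (concat (map CG₂ (toList bs))) ≤ n * l₀
  EDIT-R-D []       []       _ = z≤n
  EDIT-R-D (x ∷ as) (y ∷ bs) as·bs≡0 = ≤-trans (EDIT-++-≤ (CG₁ x) _ (CG₂ y) _)
    (+-mono-≤ (EDIT-CG x y (m+n≡0⇒m≡0 _ as·bs≡0))
              (EDIT-R-D as bs (m+n≡0⇒n≡0 (toℕ x * toℕ y) as·bs≡0)))

mainTheorem4 : (d : ℕ) → 1 ≤ d → (a b : Vec Bool d) → dot a b ≡ 0 →
    EDIT (Gadgets.AG₁ d a) (Gadgets.AG₂ d b)
      ≤ 2 * Gadgets.l₂ d + Gadgets.l d + d * Gadgets.l₀ d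
mainTheorem4 d 1≤d a b a·b≡0 = begin
    EDIT (AG₁ a) (AG₂ b)
  ≤⟨ EDIT-++-deleteˡ (O ^^ l₂) (L ++ tail₁) (AG₂ b) ⟩
    length (O ^^ l₂) + EDIT (L ++ tail₁) (AG₂ b)
  ≤⟨ +-monoʳ-≤ (length (O ^^ l₂)) (EDIT-++-deleteˡ L tail₁ (AG₂ b)) ⟩
    length (O ^^ l₂) + (length L + EDIT tail₁ (AG₂ b))
  ≤⟨ +-monoʳ-≤ (length (O ^^ l₂)) (+-monoʳ-≤ (length L) EDIT-tail) ⟩
    length (O ^^ l₂) + (length L + (d * l₀ + l₂))
  ≡⟨ cong₂ _+_ (length-replicate l₂) (cong (_+ (d * l₀ + l₂)) (length-L d 1≤d)) ⟩
    l₂ + (l + (d * l₀ + l₂))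
  ≡⟨ rearrange l₂ l (d * l₀) ⟩
    2 * l₂ + l + d * l₀
  ∎
  where
  open Gadgets d
  open ≤-Reasoning
  tail₁ : Str
  tail₁ = (I ^^ l₂) ++ R a ++ (O ^^ l₂)
  EDIT-tail : EDIT tail₁ (AG₂ b) ≤ d * l₀ + l₂
  EDIT-tail = EDIT-++-sharedˡ (I ^^ l₂)
    (≤-trans (EDIT-++-≤ (R a) (O ^^ l₂) (D b) (I ^^ l₂))
      (+-mono-≤ (EDIT-R-D d a b a·b≡0) (EDIT-replicate-≤ O I l₂)))
  rearrange : ∀ x y z → x + (y + (z + x)) ≡ 2 * x + y + z
  rearrange = solve-∀
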